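{- Let $T$ be a complete binary tree with $n$ leaves, let $L(V_T)$ be its set of leaves, and let $\Pi$ be any bijection from $L(V_T)$ onto the multiset of internal nodes of $T$ in which the root appears twice (the duplicated root being identified with the root). Let $S\subseteq L(V_T)$ be nonempty with $|S|<n/2$, let $Q_\Pi = S\cup\Pi(S)\subseteq V_T$ where $\Pi(S)=\{\Pi(u)\mid u\in S\}$, and let $X$ be a maximal $S$-occupied subtree of $T$ with node set $V_X$. Then $|\partial Q_\Pi\cap V_X|\ge |\overline{Q_\Pi}\cap V_X|/2$.
   Context: A subtree of $T$ is a node together with all its descendants. A subtree $X$ is $S$-occupied if all of its leaf nodes belong to $S$; it is maximal if no $S$-occupied subtree of $T$ other than $X$ contains $X$ as a subtree. $\partial Q$ denotes the node boundary of $Q$ in $T$ (nodes of $T$ not in $Q$ adjacent in $T$ to some node of $Q$), and $\overline{Q}=V_T\setminus Q$. -}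

module Defs where

open import Data.Nat using (ℕ; zero; suc; _<_)
open import Data.Bool using (Bool; true; false; _∧_; _∨_; not)
open import Data.List using (List; []; _∷_; _++_; map; length; filterᵇ)
open import Data.Bool.ListAction using (any)
open import Data.Product using (Σ; _,_; proj₁; _×_)
open import Data.Sum using (_⊎_; inj₁; inj₂)
open import Data.Unit using (⊤)
open import Relation.Binary.PropositionalEquality using (_≡_; refl; cong)

-- Nodes of the complete (perfect) binary tree of depth d (2^d leaves),
-- addressed by the path from the root.
data Node : ℕ → Set where
  root  : ∀ {d} → Node d
  left  : ∀ {d} → Node d → Node (suc d)
  right : ∀ {d} → Node d → Node (suc d)

depth : ∀ {d} → Node d → ℕ
depth root      = 0
depth (left x)  = suc (depth x)
depth (right x) = suc (depth x)

_==_ : ∀ {d} → Node d → Node d → Bool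
root    == root    = true
left x  == left y  = x == y
right x == right y = x == y
_       == _       = false

_⊑ᵇ_ : ∀ {d} → Node d → Node d → Bool
root    ⊑ᵇ _       = true
left x  ⊑ᵇ left y  = x ⊑ᵇ y
right x ⊑ᵇ right y = x ⊑ᵇ y
_       ⊑ᵇ _       = false

children : ∀ {d} → Node d → List (Node d)
children {zero}  root      = []
children {suc d} root      = left root ∷ right root ∷ []
children (left x)          = map left (children x)
children (right x)         = map right (children x)

adj : ∀ {d} → Node d → Node d → Bool
adj x y = any (_== y) (children x) ∨ any (_== x) (children y)

allNodes : ∀ d → List (Node d)
allNodes zero    = root ∷ []
allNodes (suc d) = root ∷ (map left (allNodes d) ++ map right (allNodes d))

IsLeaf : ∀ {d} → Node d → Set
IsLeaf {d} x = depth x ≡ d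

Leaf : ℕ → Set
Leaf d = Σ (Node d) IsLeaf

Internal : ℕ → Set
Internal d = Σ (Node d) (λ x → depth x < d)

allLeaves : ∀ d → List (Leaf d)
allLeaves zero    = (root , refl) ∷ []
allLeaves (suc d) = map (λ { (x , p) → left x , cong suc p }) (allLeaves d)
                 ++ map (λ { (x , p) → right x , cong suc p }) (allLeaves d)

count : ∀ {d} → (Node d → Bool) → ℕ
count {d} P = length (filterᵇ P (allNodes d))

-- The multiset of internal nodes with the root taken twice is modelled as
-- Internal d ⊎ ⊤ (inj₂ _ is the second copy of the root); `embed` identifies
-- the duplicated root with the root.
embed : ∀ {d} → Internal d ⊎ ⊤ → Node d
embed (inj₁ (x , _)) = x
embed (inj₂ _)       = root

Qset : ∀ {d} → (Node d → Bool) → (Leaf d → Internal d ⊎ ⊤) → Node d → Bool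
Qset {d} S π x = S x ∨ any (λ u → S (proj₁ u) ∧ (embed (π u) == x)) (allLeaves d)

boundary : ∀ {d} → (Node d → Bool) → Node d → Bool
boundary {d} Q x = not (Q x) ∧ any (λ y → Q y ∧ adj x y) (allNodes d)

Occupied : ∀ {d} → (Node d → Bool) → Node d → Set
Occupied S r = ∀ (u : Leaf _) → (r ⊑ᵇ proj₁ u) ≡ true → S (proj₁ u) ≡ true

MaximalOccupied : ∀ {d} → (Node d → Bool) → Node d → Set
MaximalOccupied S r =
  Occupied S r × (∀ r′ → Occupied S r′ → (r′ ⊑ᵇ r) ≡ true → r′ ≡ r)

-- Only the leaves below r matter, and they lie in S ⊆ Q.
-- For any Q containing all leaves of a perfect binary tree, induction on the
-- depth gives
--   [root ∉ Q] + #(nodes ∉ Q) ≤ 2 · #(nodes ∉ Q with a child in Q),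
-- the extra term paying for a node outside Q whose two children are both
-- outside Q. A node outside Q with a child in Q lies on the boundary of Q.
module Submission where

open import Defs
open import Data.Nat using (ℕ; zero; suc; _+_; _*_; _^_; _<_; _≤_; z≤n; s≤s)
open import Data.Nat.Properties
  using (≤-refl; ≤-trans; m≤n+m; +-mono-≤; +-monoˡ-≤; +-monoʳ-≤; +-identityʳ; *-monoʳ-≤; module ≤-Reasoning)
open import Data.Nat.Tactic.RingSolver using (solve)
open import Data.Bool using (Bool; true; false; T; _∧_; _∨_; not)
open import Data.Bool.Properties using (∧-zeroʳ; ∧-identityʳ; T-∧; T-∨)
open import Data.Bool.ListAction using (any; or)
open import Data.List using ([]; _∷_; _++_; map; length; filterᵇ)
open import Data.List.Properties using (length-++; filter-++; map-∘)
open import Data.List.Membership.Propositional using (_∈_; find; lose)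
open import Data.List.Membership.Propositional.Properties using (∈-map⁺; ∈-++⁺ˡ; ∈-++⁺ʳ)
open import Data.List.Relation.Unary.Any using (here; there)
open import Data.List.Relation.Unary.Any.Properties using (any⁺; any⁻)
open import Data.Product using (_,_)
open import Data.Sum using (_⊎_; inj₁)
open import Data.Unit using (⊤; tt)
open import Data.Empty using (⊥-elim)
open import Function using (_∘_)
open import Relation.Nullary.Decidable using (T?)
open import Function.Bundles using (_↔_; Inverse; Equivalence)
open import Relation.Binary.PropositionalEquality
  using (_≡_; refl; sym; trans; cong; cong₂; module ≡-Reasoning)

bit : Bool → ℕ
bit false = 0
bit true  = 1

bit-mono : ∀ {a b} → (T a → T b) → bit a ≤ bit b
bit-mono {false}         _   = z≤n
bit-mono {true}  {true}  _   = ≤-refl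
bit-mono {true}  {false} a⇒b = ⊥-elim (a⇒b tt)

length-filterᵇ-map : ∀ {A B : Set} (p : B → Bool) (f : A → B) xs →
  length (filterᵇ p (map f xs)) ≡ length (filterᵇ (p ∘ f) xs)
length-filterᵇ-map p f []       = refl
length-filterᵇ-map p f (x ∷ xs) with p (f x)
... | true  = cong suc (length-filterᵇ-map p f xs)
... | false = length-filterᵇ-map p f xs

length-filterᵇ-∷ : ∀ {A : Set} (p : A → Bool) x xs →
  length (filterᵇ p (x ∷ xs)) ≡ bit (p x) + length (filterᵇ p xs)
length-filterᵇ-∷ p x xs with p x
... | true  = refl
... | false = refl

count-root : (P : Node 0 → Bool) → count P ≡ bit (P root)
count-root P = trans (length-filterᵇ-∷ P root []) (+-identityʳ (bit (P root)))

count-split : ∀ {d} (P : Node (suc d) → Bool) →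
  count P ≡ bit (P root) + (count (P ∘ left) + count (P ∘ right))
count-split {d} P =
  trans (length-filterᵇ-∷ P root (map left ns ++ map right ns)) (cong (bit (P root) +_) subtrees)
  where
  open ≡-Reasoning
  ns = allNodes d
  subtrees : length (filterᵇ P (map left ns ++ map right ns)) ≡ count (P ∘ left) + count (P ∘ right)
  subtrees = begin
    length (filterᵇ P (map left ns ++ map right ns))
      ≡⟨ cong length (filter-++ (T? ∘ P) (map left ns) (map right ns)) ⟩
    length (filterᵇ P (map left ns) ++ filterᵇ P (map right ns))
      ≡⟨ length-++ (filterᵇ P (map left ns)) ⟩
    length (filterᵇ P (map left ns)) + length (filterᵇ P (map right ns))
      ≡⟨ cong₂ _+_ (length-filterᵇ-map P left ns) (length-filterᵇ-map P right ns) ⟩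
    count (P ∘ left) + count (P ∘ right) ∎

count-cong : ∀ {d} {P Q : Node d → Bool} → (∀ x → P x ≡ Q x) → count P ≡ count Q
count-cong {zero}  {P} {Q} P≡Q =
  trans (count-root P) (trans (cong bit (P≡Q root)) (sym (count-root Q)))
count-cong {suc d} {P} {Q} P≡Q = trans (count-split P) (trans
  (cong₂ _+_ (cong bit (P≡Q root))
             (cong₂ _+_ (count-cong (P≡Q ∘ left)) (count-cong (P≡Q ∘ right))))
  (sym (count-split Q)))

count-mono : ∀ {d} {P Q : Node d → Bool} → (∀ x → T (P x) → T (Q x)) → count P ≤ count Q
count-mono {zero}  {P} {Q} P⇒Q = begin
    count P       ≡⟨ count-root P ⟩
    bit (P root)  ≤⟨ bit-mono (P⇒Q root) ⟩
    bit (Q root)  ≡⟨ count-root Q ⟨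
    count Q ∎
  where open ≤-Reasoning
count-mono {suc d} {P} {Q} P⇒Q = begin
    count P
      ≡⟨ count-split P ⟩
    bit (P root) + (count (P ∘ left) + count (P ∘ right))
      ≤⟨ +-mono-≤ (bit-mono (P⇒Q root))
                  (+-mono-≤ (count-mono (P⇒Q ∘ left)) (count-mono (P⇒Q ∘ right))) ⟩
    bit (Q root) + (count (Q ∘ left) + count (Q ∘ right))
      ≡⟨ count-split Q ⟨
    count Q ∎
  where open ≤-Reasoning

count-false : ∀ {d} → count {d} (λ _ → false) ≡ 0
count-false {zero}  = refl
count-false {suc d} = trans (count-split {d} (λ _ → false)) (cong₂ _+_ (count-false {d}) (count-false {d}))

_↾_ : ∀ {d} → (Node d → Bool) → Node d → Node d → Bool
(P ↾ r) x = P x ∧ (r ⊑ᵇ x)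

↾-mono : ∀ {d} {P P′ : Node d → Bool} (r : Node d) →
  (∀ x → T (P x) → T (P′ x)) → ∀ x → T ((P ↾ r) x) → T ((P′ ↾ r) x)
↾-mono r P⇒P′ x Px∧r⊑x with Equivalence.to T-∧ Px∧r⊑x
... | Px , r⊑x = Equivalence.from T-∧ (P⇒P′ x Px , r⊑x)

count-↾-left : ∀ {d} (P : Node (suc d) → Bool) (r : Node d) →
  count (P ↾ left r) ≡ count ((P ∘ left) ↾ r)
count-↾-left {d} P r = begin
  count (P ↾ left r)
    ≡⟨ count-split (P ↾ left r) ⟩
  bit (P root ∧ false) + (count ((P ∘ left) ↾ r) + count (λ x → P (right x) ∧ false))
    ≡⟨ cong₂ (λ a b → bit a + (count ((P ∘ left) ↾ r) + b))
             (∧-zeroʳ (P root)) (trans (count-cong (∧-zeroʳ ∘ P ∘ right)) (count-false {d})) ⟩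
  count ((P ∘ left) ↾ r) + 0
    ≡⟨ +-identityʳ _ ⟩
  count ((P ∘ left) ↾ r) ∎
  where open ≡-Reasoning

count-↾-right : ∀ {d} (P : Node (suc d) → Bool) (r : Node d) →
  count (P ↾ right r) ≡ count ((P ∘ right) ↾ r)
count-↾-right {d} P r = begin
  count (P ↾ right r)
    ≡⟨ count-split (P ↾ right r) ⟩
  bit (P root ∧ false) + (count (λ x → P (left x) ∧ false) + count ((P ∘ right) ↾ r))
    ≡⟨ cong₂ (λ a b → bit a + (b + count ((P ∘ right) ↾ r)))
             (∧-zeroʳ (P root)) (trans (count-cong (∧-zeroʳ ∘ P ∘ left)) (count-false {d})) ⟩
  count ((P ∘ right) ↾ r) ∎
  where open ≡-Reasoning

lowerBoundary : ∀ {d} → (Node d → Bool) → Node d → Bool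
lowerBoundary Q x = not (Q x) ∧ any Q (children x)

lowerBoundary-left : ∀ {d} (Q : Node (suc d) → Bool) (x : Node d) →
  lowerBoundary Q (left x) ≡ lowerBoundary (Q ∘ left) x
lowerBoundary-left Q x = cong (λ bs → not (Q (left x)) ∧ or bs) (sym (map-∘ (children x)))

lowerBoundary-right : ∀ {d} (Q : Node (suc d) → Bool) (x : Node d) →
  lowerBoundary Q (right x) ≡ lowerBoundary (Q ∘ right) x
lowerBoundary-right Q x = cong (λ bs → not (Q (right x)) ∧ or bs) (sym (map-∘ (children x)))

root-step : ∀ q q₁ q₂ →
  bit (not q) + bit (not q) ≤ 2 * bit (not q ∧ (q₁ ∨ (q₂ ∨ false))) + bit (not q₁) + bit (not q₂)
root-step true  _     _     = z≤n
root-step false true  _     = s≤s (s≤s z≤n)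
root-step false false true  = s≤s (s≤s z≤n)
root-step false false false = s≤s (s≤s z≤n)

twice-split : ∀ {a e b c n₁ n₂ m₁ m₂} →
  a + a ≤ 2 * e + b + c → b + n₁ ≤ 2 * m₁ → c + n₂ ≤ 2 * m₂ →
  a + (a + (n₁ + n₂)) ≤ 2 * (e + (m₁ + m₂))
twice-split {a} {e} {b} {c} {n₁} {n₂} {m₁} {m₂} top sub₁ sub₂ = begin
  a + (a + (n₁ + n₂))             ≡⟨ solve vars ⟩
  a + a + n₁ + n₂                 ≤⟨ +-monoˡ-≤ n₂ (+-monoˡ-≤ n₁ top) ⟩
  2 * e + b + c + n₁ + n₂         ≡⟨ solve vars ⟩
  2 * e + (b + n₁) + (c + n₂)     ≤⟨ +-mono-≤ (+-monoʳ-≤ (2 * e) sub₁) sub₂ ⟩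
  2 * e + 2 * m₁ + 2 * m₂         ≡⟨ solve vars ⟩
  2 * (e + (m₁ + m₂))             ∎
  where
  open ≤-Reasoning
  vars = a ∷ e ∷ b ∷ c ∷ n₁ ∷ n₂ ∷ m₁ ∷ m₂ ∷ []

outside≤2*lowerBoundary : ∀ {d} (Q : Node d → Bool) → (∀ x → IsLeaf x → Q x ≡ true) →
  bit (not (Q root)) + count (not ∘ Q) ≤ 2 * count (lowerBoundary Q)
outside≤2*lowerBoundary {zero}  Q leaves⊆Q rewrite leaves⊆Q root refl = z≤n
outside≤2*lowerBoundary {suc d} Q leaves⊆Q = begin
  a + count (not ∘ Q)
    ≡⟨ cong (a +_) (count-split (not ∘ Q)) ⟩
  a + (a + (count (not ∘ Q ∘ left) + count (not ∘ Q ∘ right)))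
    ≤⟨ twice-split {a} {e} {m₁ = b₁} {m₂ = b₂} (root-step (Q root) (Q (left root)) (Q (right root)))
                   (outside≤2*lowerBoundary (Q ∘ left)  (λ x → leaves⊆Q (left x)  ∘ cong suc))
                   (outside≤2*lowerBoundary (Q ∘ right) (λ x → leaves⊆Q (right x) ∘ cong suc)) ⟩
  2 * (e + (b₁ + b₂))
    ≡⟨ cong (2 *_) (sym (trans (count-split (lowerBoundary Q))
         (cong (e +_) (cong₂ _+_ (count-cong (lowerBoundary-left Q))
                                 (count-cong (lowerBoundary-right Q)))))) ⟩
  2 * count (lowerBoundary Q) ∎
  where
  open ≤-Reasoning
  a  = bit (not (Q root))
  e  = bit (lowerBoundary Q root)
  b₁ = count (lowerBoundary (Q ∘ left))
  b₂ = count (lowerBoundary (Q ∘ right))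

outside↾≤2*lowerBoundary↾ : ∀ {d} (r : Node d) (Q : Node d → Bool) →
  (∀ x → IsLeaf x → (r ⊑ᵇ x) ≡ true → Q x ≡ true) →
  count ((not ∘ Q) ↾ r) ≤ 2 * count (lowerBoundary Q ↾ r)
outside↾≤2*lowerBoundary↾ root Q leaves⊆Q = begin
  count ((not ∘ Q) ↾ root)         ≡⟨ count-cong (∧-identityʳ ∘ not ∘ Q) ⟩
  count (not ∘ Q)                  ≤⟨ m≤n+m _ _ ⟩
  bit (not (Q root)) + count (not ∘ Q)
                                   ≤⟨ outside≤2*lowerBoundary Q (λ x leaf → leaves⊆Q x leaf refl) ⟩
  2 * count (lowerBoundary Q)      ≡⟨ cong (2 *_) (count-cong (∧-identityʳ ∘ lowerBoundary Q)) ⟨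
  2 * count (lowerBoundary Q ↾ root) ∎
  where open ≤-Reasoning
outside↾≤2*lowerBoundary↾ (left r) Q leaves⊆Q = begin
  count ((not ∘ Q) ↾ left r)                 ≡⟨ count-↾-left (not ∘ Q) r ⟩
  count ((not ∘ Q ∘ left) ↾ r)               ≤⟨ outside↾≤2*lowerBoundary↾ r (Q ∘ left) (λ x → leaves⊆Q (left x) ∘ cong suc) ⟩
  2 * count (lowerBoundary (Q ∘ left) ↾ r)   ≡⟨ cong (2 *_) (count-cong (λ x → cong (_∧ (r ⊑ᵇ x)) (lowerBoundary-left Q x))) ⟨
  2 * count ((lowerBoundary Q ∘ left) ↾ r)   ≡⟨ cong (2 *_) (count-↾-left (lowerBoundary Q) r) ⟨
  2 * count (lowerBoundary Q ↾ left r)       ∎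
  where open ≤-Reasoning
outside↾≤2*lowerBoundary↾ (right r) Q leaves⊆Q = begin
  count ((not ∘ Q) ↾ right r)                ≡⟨ count-↾-right (not ∘ Q) r ⟩
  count ((not ∘ Q ∘ right) ↾ r)              ≤⟨ outside↾≤2*lowerBoundary↾ r (Q ∘ right) (λ x → leaves⊆Q (right x) ∘ cong suc) ⟩
  2 * count (lowerBoundary (Q ∘ right) ↾ r)  ≡⟨ cong (2 *_) (count-cong (λ x → cong (_∧ (r ⊑ᵇ x)) (lowerBoundary-right Q x))) ⟨
  2 * count ((lowerBoundary Q ∘ right) ↾ r)  ≡⟨ cong (2 *_) (count-↾-right (lowerBoundary Q) r) ⟨
  2 * count (lowerBoundary Q ↾ right r)      ∎
  where open ≤-Reasoning

==-refl : ∀ {d} (x : Node d) → T (x == x)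
==-refl root      = tt
==-refl (left x)  = ==-refl x
==-refl (right x) = ==-refl x

∈-allNodes : ∀ {d} (x : Node d) → x ∈ allNodes d
∈-allNodes {zero}  root      = here refl
∈-allNodes {suc d} root      = here refl
∈-allNodes {suc d} (left x)  = there (∈-++⁺ˡ (∈-map⁺ left (∈-allNodes x)))
∈-allNodes {suc d} (right x) = there (∈-++⁺ʳ (map left (allNodes d)) (∈-map⁺ right (∈-allNodes x)))

lowerBoundary⊆boundary : ∀ {d} (Q : Node d → Bool) x → T (lowerBoundary Q x) → T (boundary Q x)
lowerBoundary⊆boundary Q x x∈lb with Equivalence.to T-∧ x∈lb
... | x∉Q , some-child∈Q with find (any⁻ Q (children x) some-child∈Q)
... | c , c∈children , c∈Q =
  Equivalence.from T-∧ (x∉Q , any⁺ _ (lose (∈-allNodes c) (Equivalence.from T-∧ (c∈Q , x~c))))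
  where
  x~c : T (adj x c)
  x~c = Equivalence.from T-∨ (inj₁ (any⁺ (_== c) (lose c∈children (==-refl c))))

lemma3 : (d : ℕ) (Π : Leaf d ↔ (Internal d ⊎ ⊤)) (S : Node d → Bool)
    → (∀ x → S x ≡ true → IsLeaf x)
    → 0 < count S
    → 2 * count S < 2 ^ d
    → (r : Node d) → MaximalOccupied S r
    → count (λ x → not (Qset S (Inverse.to Π) x) ∧ (r ⊑ᵇ x))
        ≤ 2 * count (λ x → boundary (Qset S (Inverse.to Π)) x ∧ (r ⊑ᵇ x))
lemma3 d Π S _ _ _ r (occupied , _) = ≤-trans
  (outside↾≤2*lowerBoundary↾ r Q leaves⊆Q)
  (*-monoʳ-≤ 2 (count-mono (↾-mono r (lowerBoundary⊆boundary Q))))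
  where
  Q = Qset S (Inverse.to Π)
  leaves⊆Q : ∀ x → IsLeaf x → (r ⊑ᵇ x) ≡ true → Q x ≡ true
  leaves⊆Q x leaf below-r rewrite occupied (x , leaf) below-r = refl
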